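{- Let $G$ be a finite simple undirected graph, let $r\in\mathbb{N}$ and let $\ell=\mathrm{wcol}_{2r}(G)$. Then splitter wins the simple $\ell$-round radius-$r$ splitter game on $G$.
   Context: For a linear order $L$ of $V(G)$ and $v\in V(G)$, a vertex $u$ is weakly $s$-reachable from $v$ with respect to $L$ if there is a path of length at most $s$ connecting $u$ and $v$ such that $u$ is the $L$-minimum vertex of the path; $\mathrm{WReach}_s[G,L,v]$ is the set of such vertices (it contains $v$), and $\mathrm{wcol}_s(G)=\min_L\max_{v\in V(G)}|\mathrm{WReach}_s[G,L,v]|$ over all linear orders $L$ of $V(G)$. For a graph $H$, $N_r^H(v)$ denotes the set of vertices at distance at most $r$ from $v$ in $H$. The simple $\ell$-round radius-$r$ splitter game on $G$ is played by connector and splitter: let $G_0:=G$; in round $i+1$ connector chooses a vertex $v_{i+1}\in V(G_i)$, then splitter picks a vertex $w_{i+1}\in N_r^{G_i}(v_{i+1})$, and $G_{i+1}:=G_i[N_r^{G_i}(v_{i+1})\setminus\{w_{i+1}\}]$. Splitter wins if $G_{i+1}$ is the empty graph; otherwise the game continues on $G_{i+1}$. If splitter has not won after $\ell$ rounds, connector wins. Splitter wins the game if she has a strategy (a function choosing her move from the history of the play and connector's current move) such that she wins every play in which she follows it. -}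

module Defs where

open import Data.Nat using (ℕ; zero; suc; _≤_)
open import Data.Fin using (Fin) renaming (_≤_ to _≤ᶠ_)
open import Data.Fin.Permutation using (Permutation′; _⟨$⟩ʳ_)
open import Data.Bool using (Bool; true; false)
open import Data.List using (List; []; _∷_; _++_; length; head; last)
open import Data.List.Relation.Unary.All using (All)
open import Data.List.Relation.Unary.Linked using (Linked)
open import Data.List.Relation.Unary.Unique.Propositional using (Unique)
open import Data.List.Membership.Propositional using (_∈_)
open import Data.Maybe using (Maybe; just)
open import Data.Product using (Σ; _×_; _,_)
open import Data.Sum using (_⊎_)
open import Data.Empty using (⊥)
open import Data.Unit using (⊤)
open import Relation.Binary.PropositionalEquality using (_≡_; _≢_)

record Graph : Set where
  field
    n      : ℕ
    adj    : Fin n → Fin n → Bool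
    sym    : ∀ u v → adj u v ≡ adj v u
    irrefl : ∀ v → adj v v ≡ false

open Graph public

V : Graph → Set
V G = Fin (n G)

Adj : (G : Graph) → V G → V G → Set
Adj G u v = adj G u v ≡ true

-- A path of G whose vertex list is xs, starting at u, ending at v,
-- with at most s edges (i.e. at most s+1 vertices), all distinct.
IsPath : (G : Graph) → List (V G) → V G → V G → ℕ → Set
IsPath G xs u v s =
  Linked (Adj G) xs × head xs ≡ just u × last xs ≡ just v
  × Unique xs × length xs ≤ suc s

-- Linear orders of V(G), given as a bijection to positions.
LinearOrder : Graph → Set
LinearOrder G = Permutation′ (n G)

_≤[_]_ : {G : Graph} → V G → LinearOrder G → V G → Set
u ≤[ L ] w = (L ⟨$⟩ʳ u) ≤ᶠ (L ⟨$⟩ʳ w)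

WReach : (G : Graph) → LinearOrder G → ℕ → V G → V G → Set
WReach G L s v u =
  Σ (List (V G)) λ xs → IsPath G xs v u s × All (λ w → _≤[_]_ {G} u L w) xs

-- cardinality bounds for (possibly non-decidable) vertex sets
AtMost : {A : Set} → ℕ → (A → Set) → Set
AtMost {A} k P = Σ (List A) λ xs → length xs ≤ k × (∀ u → P u → u ∈ xs)

AtLeast : {A : Set} → ℕ → (A → Set) → Set
AtLeast {A} k P = Σ (List A) λ xs → length xs ≡ k × Unique xs × All P xs

-- ℓ = wcol_s(G) = min_L max_v |WReach_s[G,L,v]|  (max over no vertices = 0)
IsWcol : Graph → ℕ → ℕ → Set
IsWcol G s ℓ =
  (Σ (LinearOrder G) λ L → ∀ v → AtMost ℓ (WReach G L s v))
  × (∀ L → ℓ ≡ 0 ⊎ Σ (V G) λ v → AtLeast ℓ (WReach G L s v))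

-- u ∈ N_r^{G[S]}(v): path of length ≤ r inside the induced subgraph G[S]
Nbhd : (G : Graph) → (V G → Set) → ℕ → V G → V G → Set
Nbhd G S r v u = Σ (List (V G)) λ xs → IsPath G xs v u r × All S xs

-- splitter strategies: history of (connector move, splitter move) pairs,
-- plus connector's current move, to splitter's move
History : Graph → Set
History G = List (V G × V G)

Strategy : Graph → Set
Strategy G = History G → V G → V G

-- Following σ from current graph G[S] with history h, splitter wins within k
-- further rounds (for every play of connector).  With 0 rounds left, splitter
-- has won iff the current graph is empty.
WinsWithin : (G : Graph) → ℕ → Strategy G → History G → (V G → Set) → ℕ → Set
WinsWithin G r σ h S zero = ∀ v → S v → ⊥
WinsWithin G r σ h S (suc k) =
  ∀ v → S v →
    Nbhd G S r v (σ h v)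
    × WinsWithin G r σ (h ++ ((v , σ h v) ∷ []))
        (λ u → Nbhd G S r v u × u ≢ σ h v) k

SplitterWins : Graph → ℕ → ℕ → Set
SplitterWins G r ℓ =
  Σ (Strategy G) λ σ → WinsWithin G r σ [] (λ _ → ⊤) ℓ

-- Splitter answers every connector move v with the L-minimum c of the current
-- arena's r-ball around v, where L is an order witnessing wcol_{2r}(G) ≤ ℓ.  Every
-- vertex x that survives into the next arena lies in that ball, so x reaches c by a
-- walk of length ≤ 2r through v on which c is L-minimal: c ∈ WReach_{2r}[G,L,x].
-- Hence a vertex alive after i rounds weakly reaches all i (distinct) splitter moves
-- and itself, so no vertex survives ℓ rounds.
module Submission where

open import Defs
open import Data.Nat using (ℕ; zero; suc; _+_; _*_; _≤_; z≤n; s≤s)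
open import Data.Nat.Properties using (≤-refl; ≤-reflexive; ≤-trans; n≤1+n; m≤n⇒m≤1+n; m≤n+m; +-suc; +-identityʳ; <-irrefl)
open import Data.Fin using (Fin; zero; suc) renaming (_≤_ to _≤ᶠ_)
open import Data.Fin.Properties using (any?) renaming (_≟_ to _≟ᶠ_)
open import Data.Fin.Permutation using (_⟨$⟩ʳ_; _⟨$⟩ˡ_; inverseʳ; inverseˡ)
open import Data.Bool using (true) renaming (_≟_ to _≟ᵇ_)
open import Data.List using (List; []; _∷_; _++_; length; last; foldl)
open import Data.List.Properties using (length-removeAt′; foldl-∷ʳ)
open import Data.List.Relation.Unary.All as All using (All; []; _∷_)
open import Data.List.Relation.Unary.All.Properties using (¬Any⇒All¬)
open import Data.List.Relation.Unary.Any using (here; there; index; _─_)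
open import Data.List.Relation.Unary.Linked as Linked using (Linked; [-]; _∷_)
open import Data.List.Relation.Unary.AllPairs using ([]; _∷_)
open import Data.List.Relation.Unary.Unique.Propositional as Unique using (Unique)
open import Data.List.Membership.Propositional using (_∈_)
open import Data.List.Membership.DecPropositional using (_∈?_)
open import Data.List.Relation.Binary.Subset.Propositional using (_⊆_)
open import Data.Maybe using (just)
open import Data.Product using (Σ; ∃; _×_; _,_; proj₁; proj₂)
open import Function using (_∘_)
open import Data.Sum using (_⊎_; inj₁; inj₂; [_,_]′)
open import Data.Empty using (⊥-elim)
open import Data.Unit using (⊤; tt)
open import Relation.Nullary using (Dec; yes; no; ¬_; ¬?)
open import Relation.Nullary.Decidable using (_×-dec_; map′)
open import Relation.Unary using (Pred; Decidable)
import Relation.Binary.PropositionalEquality as ≡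
open ≡ using (_≡_; _≢_; refl; subst)

∈-─ : ∀ {A : Set} {x u : A} {ys} (x∈ys : x ∈ ys) → u ∈ ys → u ≢ x → u ∈ (ys ─ x∈ys)
∈-─ (here refl) (here refl) u≢x = ⊥-elim (u≢x refl)
∈-─ (here refl) (there u∈ys) u≢x = u∈ys
∈-─ (there x∈ys) (here refl) u≢x = here refl
∈-─ (there x∈ys) (there u∈ys) u≢x = there (∈-─ x∈ys u∈ys u≢x)

Unique-⊆⇒length≤ : ∀ {A : Set} {xs ys : List A} → Unique xs → xs ⊆ ys → length xs ≤ length ys
Unique-⊆⇒length≤ [] _ = z≤n
Unique-⊆⇒length≤ {ys = ys} (x≢xs ∷ !xs) xs⊆ys =
  subst (_ ≤_) (≡.sym (length-removeAt′ ys (index x∈ys)))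
    (s≤s (Unique-⊆⇒length≤ !xs (λ u∈xs →
      ∈-─ x∈ys (xs⊆ys (there u∈xs)) (≡.≢-sym (All.lookup x≢xs u∈xs)))))
  where x∈ys = xs⊆ys (here refl)

AtMost⇒length≤ : ∀ {A : Set} {P : A → Set} {k xs} → AtMost k P → Unique xs → All P xs → length xs ≤ k
AtMost⇒length≤ (ys , ys≤k , P⊆ys) !xs Pxs =
  ≤-trans (Unique-⊆⇒length≤ !xs (λ u∈xs → P⊆ys _ (All.lookup Pxs u∈xs))) ys≤k

Least : ∀ {n} → Pred (Fin n) _ → Fin n → Set
Least Q i = Q i × (∀ j → Q j → i ≤ᶠ j)

least? : ∀ {n} (Q : Pred (Fin n) _) → Decidable Q → ∃ (Least Q) ⊎ (∀ i → ¬ Q i)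
least? {zero} Q Q? = inj₂ λ ()
least? {suc n} Q Q? with Q? zero | least? (λ i → Q (suc i)) (λ i → Q? (suc i))
... | yes q | _ = inj₁ (zero , q , λ _ _ → z≤n)
... | no ¬q | inj₁ (i , q , below) =
  inj₁ (suc i , q , λ { zero q₀ → ⊥-elim (¬q q₀) ; (suc j) qj → s≤s (below j qj) })
... | no ¬q | inj₂ none = inj₂ λ { zero → ¬q ; (suc i) → none i }

module Walks (G : Graph) where

  data Walk (S : V G → Set) : ℕ → V G → V G → Set where
    nil  : ∀ {k v} → S v → Walk S k v v
    cons : ∀ {k v y u} → S v → Adj G v y → Walk S k y u → Walk S (suc k) v u

  Walk-map : ∀ {S T : V G → Set} → (∀ {z} → S z → T z) → ∀ {k v u} → Walk S k v u → Walk T k v u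
  Walk-map f (nil su) = nil (f su)
  Walk-map f (cons sv e w) = cons (f sv) e (Walk-map f w)

  module _ {S : V G → Set} where

    Walk-source : ∀ {k v u} → Walk S k v u → S v
    Walk-source (nil sv) = sv
    Walk-source (cons sv _ _) = sv

    Walk-target : ∀ {k v u} → Walk S k v u → S u
    Walk-target (nil su) = su
    Walk-target (cons _ _ w) = Walk-target w

    Walk-mono : ∀ {k k′ v u} → k ≤ k′ → Walk S k v u → Walk S k′ v u
    Walk-mono _ (nil su) = nil su
    Walk-mono (s≤s k≤k′) (cons sv e w) = cons sv e (Walk-mono k≤k′ w)

    Walk-inBall : ∀ {k v u} → Walk S k v u → Walk (Walk S k v) k v u
    Walk-inBall (nil sv) = nil (nil sv)
    Walk-inBall (cons sv e w) = cons (nil sv) e (Walk-map (cons sv e) (Walk-inBall w))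

    Walk-ʳ++ : ∀ {a b v x u} → Walk S a v x → Walk S b v u → Walk S (a + b) x u
    Walk-ʳ++ {a} {b} (nil _) w = Walk-mono (m≤n+m b a) w
    Walk-ʳ++ {suc a} {b} (cons _ e w₁) w₂ =
      Walk-mono (≤-reflexive (+-suc a b)) (Walk-ʳ++ w₁ (cons (Walk-source w₁) (≡.trans (sym G _ _) e) w₂))

    Walk? : Decidable S → ∀ k v u → Dec (Walk S k v u)
    Walk? S? k v u with S? v | v ≟ᶠ u
    ... | no ¬sv | _ = no λ { (nil sv) → ¬sv sv ; (cons sv _ _) → ¬sv sv }
    ... | yes sv | yes refl = yes (nil sv)
    Walk? S? zero v u | yes sv | no v≢u = no λ { (nil _) → v≢u refl }
    Walk? S? (suc k) v u | yes sv | no v≢u with any? (λ y → (adj G v y ≟ᵇ true) ×-dec Walk? S? k y u)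
    ... | yes (y , e , w) = yes (cons sv e w)
    ... | no ¬step = no λ { (nil _) → v≢u refl ; (cons {y = y} _ e w) → ¬step (y , e , w) }

    Nbhd⇒Walk : ∀ {k v u} → Nbhd G S k v u → Walk S k v u
    Nbhd⇒Walk ([] , (_ , () , _) , _)
    Nbhd⇒Walk (_ ∷ [] , (_ , refl , refl , _) , sv ∷ []) = nil sv
    Nbhd⇒Walk {zero} (_ ∷ _ ∷ _ , (_ , _ , _ , _ , s≤s ()) , _)
    Nbhd⇒Walk {suc k} (_ ∷ y ∷ xs , (e ∷ lk , refl , lu , _ ∷ !xs , s≤s len) , sv ∷ sxs) =
      cons sv e (Nbhd⇒Walk (y ∷ xs , (lk , refl , lu , !xs , len) , sxs))

    Nbhd-suffix : ∀ {k v u xs} → v ∈ xs → Linked (Adj G) xs → last xs ≡ just u → Unique xs →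
                  length xs ≤ suc k → All S xs → Nbhd G S k v u
    Nbhd-suffix (here refl) lk lu !xs len sxs = _ , (lk , refl , lu , !xs , len) , sxs
    Nbhd-suffix (there {xs = []} ()) _ _ _ _ _
    Nbhd-suffix (there {xs = _ ∷ _} v∈xs) lk lu (_ ∷ !xs) len (_ ∷ sxs) =
      Nbhd-suffix v∈xs (Linked.tail lk) lu !xs (≤-trans (n≤1+n _) len) sxs

    Nbhd-cons : ∀ {k v y u} → S v → Adj G v y → Nbhd G S k y u → Nbhd G S (suc k) v u
    Nbhd-cons sv e ([] , (_ , () , _) , _)
    Nbhd-cons {v = v} sv e (xs@(_ ∷ _) , (lk , refl , lu , !xs , len) , sxs) with _∈?_ _≟ᶠ_ v xs
    ... | yes v∈xs = Nbhd-suffix v∈xs lk lu !xs (m≤n⇒m≤1+n len) sxs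
    ... | no v∉xs = v ∷ xs , (e ∷ lk , refl , lu , ¬Any⇒All¬ xs v∉xs ∷ !xs , s≤s len) , sv ∷ sxs

    Walk⇒Nbhd : ∀ {k v u} → Walk S k v u → Nbhd G S k v u
    Walk⇒Nbhd (nil sv) = _ ∷ [] , ([-] , refl , refl , [] ∷ [] , s≤s z≤n) , sv ∷ []
    Walk⇒Nbhd (cons sv e w) = Nbhd-cons sv e (Walk⇒Nbhd w)

    Nbhd? : Decidable S → ∀ k v → Decidable (Nbhd G S k v)
    Nbhd? S? k v u = map′ Walk⇒Nbhd Nbhd⇒Walk (Walk? S? k v u)

    Nbhd-target : ∀ {k v u} → Nbhd G S k v u → S u
    Nbhd-target = Walk-target ∘ Nbhd⇒Walk

module Minima (G : Graph) (L : LinearOrder G) where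
  open Walks G

  _≤L_ : V G → V G → Set
  u ≤L w = _≤[_]_ {G} u L w

  IsMinimum : (V G → Set) → V G → Set
  IsMinimum Q c = Q c × (∀ u → Q u → c ≤L u)

  minimum? : ∀ {Q} → Decidable Q → ∃ (IsMinimum Q) ⊎ (∀ v → ¬ Q v)
  minimum? {Q} Q? with least? (λ i → Q (L ⟨$⟩ˡ i)) (λ i → Q? (L ⟨$⟩ˡ i))
  ... | inj₂ none = inj₂ λ v qv → none (L ⟨$⟩ʳ v) (subst Q (≡.sym (inverseˡ L)) qv)
  ... | inj₁ (i , qi , below) = inj₁ (L ⟨$⟩ˡ i , qi , minimal)
    where
      minimal : ∀ u → Q u → (L ⟨$⟩ˡ i) ≤L u
      minimal u qu rewrite inverseʳ L {i} = below (L ⟨$⟩ʳ u) (subst Q (≡.sym (inverseˡ L)) qu)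

  WReach-self : ∀ {s} x → WReach G L s x x
  WReach-self x = Walk⇒Nbhd (nil ≤-refl)

  minimumOr : ∀ {Q} → Decidable Q → V G → V G
  minimumOr Q? d = [ proj₁ , (λ _ → d) ]′ (minimum? Q?)

  minimumOr-isMinimum : ∀ {Q d} (Q? : Decidable Q) → Q d → IsMinimum Q (minimumOr Q? d)
  minimumOr-isMinimum Q? qd with minimum? Q?
  ... | inj₁ (_ , c-min) = c-min
  ... | inj₂ none = ⊥-elim (none _ qd)

  minimum-WReach : ∀ {S s v x c} → Nbhd G S s v x → IsMinimum (Nbhd G S s v) c →
                   WReach G L (2 * s) x c
  minimum-WReach {S} {s} {v} {x} {c} x∈B (c∈B , c-min) =
    Walk⇒Nbhd (Walk-mono (≤-reflexive (≡.cong (s +_) (≡.sym (+-identityʳ s))))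
                         (Walk-ʳ++ (above x∈B) (above c∈B)))
    where
      above : ∀ {y} → Nbhd G S s v y → Walk (c ≤L_) s v y
      above y∈B = Walk-map (λ {z} z∈B → c-min z (Walk⇒Nbhd z∈B)) (Walk-inBall (Nbhd⇒Walk y∈B))

module Splitter (G : Graph) (r : ℕ) (L : LinearOrder G) where
  open Walks G
  open Minima G L

  -- A strategy sees only the history, so splitter recomputes the current arena from
  -- it; arenas are kept decidable to be able to search them for their L-minimum.
  Arena : Set₁
  Arena = Σ (V G → Set) Decidable

  nextArena : Arena → V G × V G → Arena
  nextArena (S , S?) (v , w) = (λ u → Nbhd G S r v u × u ≢ w) , λ u → Nbhd? S? r v u ×-dec ¬? (u ≟ᶠ w)

  arena : History G → Arena
  arena = foldl nextArena ((λ _ → ⊤) , λ _ → yes tt)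

  Alive : History G → V G → Set
  Alive h = proj₁ (arena h)

  Alive? : ∀ h → Decidable (Alive h)
  Alive? h = proj₂ (arena h)

  Alive-step : ∀ h v w → Alive (h ++ (v , w) ∷ []) ≡ (λ u → Nbhd G (Alive h) r v u × u ≢ w)
  Alive-step h v w = ≡.cong proj₁ (foldl-∷ʳ nextArena _ (v , w) h)

  splitter : Strategy G
  splitter h v = minimumOr (Nbhd? (Alive? h) r v) v

  splitter-minimum : ∀ h {v} → Alive h v → IsMinimum (Nbhd G (Alive h) r v) (splitter h v)
  splitter-minimum h {v} alive = minimumOr-isMinimum (Nbhd? (Alive? h) r v) (Walk⇒Nbhd (nil alive))

  Reaches : List (V G) → V G → Set
  Reaches ws x = Unique (x ∷ ws) × All (WReach G L (2 * r) x) ws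

  Reaches-step : ∀ h {v c ws} → (∀ x → Alive h x → Reaches ws x) →
                 IsMinimum (Nbhd G (Alive h) r v) c →
                 ∀ x → Nbhd G (Alive h) r v x × x ≢ c → Reaches (c ∷ ws) x
  Reaches-step h reaches c-min@(c∈B , _) x (x∈B , x≢c)
    with reaches x (Nbhd-target x∈B) | reaches _ (Nbhd-target c∈B)
  ... | (x≢ws ∷ _) , x↝ws | !c∷ws , _ = ((x≢c ∷ x≢ws) ∷ !c∷ws) , minimum-WReach x∈B c-min ∷ x↝ws

  module _ (ℓ : ℕ) (WReach-bound : ∀ v → AtMost ℓ (WReach G L (2 * r) v)) where

    splitter-winsWithin : ∀ k h ws → k + length ws ≡ ℓ → (∀ x → Alive h x → Reaches ws x) →
                          WinsWithin G r splitter h (Alive h) k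
    splitter-winsWithin zero h ws len reaches x alive with reaches x alive
    ... | !x∷ws , x↝ws = <-irrefl len (AtMost⇒length≤ (WReach-bound x) !x∷ws (WReach-self x ∷ x↝ws))
    splitter-winsWithin (suc k) h ws len reaches v alive =
      proj₁ c-min , subst (λ S → WinsWithin G r splitter h′ S k) (Alive-step h v c)
        (splitter-winsWithin k h′ (c ∷ ws) (≡.trans (+-suc k (length ws)) len) reaches′)
      where
        c : V G
        c = splitter h v
        h′ : History G
        h′ = h ++ (v , c) ∷ []
        c-min : IsMinimum (Nbhd G (Alive h) r v) c
        c-min = splitter-minimum h alive
        reaches′ : ∀ x → Alive h′ x → Reaches (c ∷ ws) x
        reaches′ x alive′ = Reaches-step h reaches c-min x (subst (λ S → S x) (Alive-step h v c) alive′)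

theorem6 : (G : Graph) (r ℓ : ℕ) → IsWcol G (2 * r) ℓ → SplitterWins G r ℓ
theorem6 G r ℓ ((L , WReach-bound) , _) =
  splitter , splitter-winsWithin ℓ WReach-bound ℓ [] [] (+-identityʳ ℓ) (λ _ _ → [] ∷ [] , [])
  where open Splitter G r L
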